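{- There exists a sequence $f_0, f_1, f_2, \ldots \in \{0,1\}$ such that for every integer $n = \langle d_0, \ldots, d_s \rangle_2 \geq 2$ (with $s \geq 1$) we have: (i) if $d_i = f_i$ for all $i = 0,\ldots,s$, then $\nu_2(H(n,2)) \geq 1 - s$; (ii) if $d_i = f_i$ for $i = 0,\ldots,r-1$ and $d_r \neq f_r$ for some positive integer $r \leq s$, then $\nu_2(H(n,2)) = r - 2s$. Precisely, the sequence is determined recursively by $f_0 = 1$ and, for every positive integer $s$, $$f_s = \begin{cases} 1 & \text{if } \nu_2\big(H(\langle f_0, \ldots, f_{s-1}, 1 \rangle_2, 2)\big) \geq 1 - s, \\ 0 & \text{otherwise}. \end{cases}$$ In particular, $f_0 = 1$, $f_1 = 1$, $f_2 = 0$.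
   Context: For integers $n \geq k \geq 1$, $H(n,k) := \sum_{1 \leq i_1 < \cdots < i_k \leq n} \frac{1}{i_1 \cdots i_k}$. $\nu_2$ denotes the $2$-adic valuation of a nonzero rational number. The notation $\langle a_0, \ldots, a_v \rangle_2 := \sum_{i=0}^v a_i 2^{v-i}$ with $a_0,\ldots,a_v \in \{0,1\}$ and $a_0 = 1$ denotes the binary representation with digits $a_0,\ldots,a_v$ (most significant first). -}

module Defs where

open import Data.Bool using (Bool; true; false; if_then_else_)
open import Data.Nat as ℕ using (ℕ; zero; suc; _+_; _*_; _∸_; _^_; _≡ᵇ_; _%_; _/_)
open import Data.Integer as ℤ using (ℤ; +_; ∣_∣)
open import Data.Rational as ℚ using (ℚ; ↥_; ↧ₙ_; 0ℚ; 1ℚ)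
open import Data.List using (List; foldr; applyUpTo)

bit : Bool → ℕ
bit true  = 1
bit false = 0

-- bin s d = ⟨ d 0 , … , d s ⟩₂ = Σ_{i=0}^{s} d_i 2^{s-i}
bin : ℕ → (ℕ → Bool) → ℕ
bin zero    d = bit (d 0)
bin (suc s) d = 2 * bin s d + bit (d (suc s))

-- 2-adic valuation of a positive natural number (fuel = the number itself);
-- returns 0 on input 0 (never used on 0)
ν₂ℕ-go : ℕ → ℕ → ℕ
ν₂ℕ-go zero    m = 0
ν₂ℕ-go (suc k) zero = 0
ν₂ℕ-go (suc k) m@(suc _) = if (m % 2) ≡ᵇ 0 then suc (ν₂ℕ-go k (m / 2)) else 0

ν₂ℕ : ℕ → ℕ
ν₂ℕ m = ν₂ℕ-go m m

-- 2-adic valuation of a nonzero rational: ν₂(numerator) - ν₂(denominator)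
-- (convention: value 0 at 0, which is never used below since H(n,2) > 0 for n ≥ 2)
ν₂ : ℚ → ℤ
ν₂ q = (+ ν₂ℕ ∣ ↥ q ∣) ℤ.- (+ ν₂ℕ (↧ₙ q))

sumℚ : List ℚ → ℚ
sumℚ = foldr ℚ._+_ 0ℚ

-- Hfrom k l n = Σ_{l < i_1 < ⋯ < i_k ≤ n} 1/(i_1 ⋯ i_k)
-- (nested sum: i_1 = suc (l + t) ranges over l+1 … n)
Hfrom : ℕ → ℕ → ℕ → ℚ
Hfrom zero    l n = 1ℚ
Hfrom (suc k) l n =
  sumℚ (applyUpTo (λ t → (+ 1 ℚ./ suc (l + t)) ℚ.* Hfrom k (suc (l + t)) n) (n ∸ l))

H : ℕ → ℕ → ℚ
H n k = Hfrom k 0 n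

{-# OPTIONS --safe #-}
-- Write h₂(n) for H(n,2). Sorting the denominators by parity gives, for m < 2^(j+1),
--   h₂(2m) = h₂(m)/4 + D(m)  with ν₂(D(m)) ≥ −(j+1),
--   h₂(2m+1) = h₂(2m) + H_{2m}/(2m+1),
-- and when 2^j ≤ m the last term has valuation exactly −(j+1), because 1/2^(j+1) is the only
-- summand of H_{2m} of maximal 2-power denominator. So if ν₂(h₂(m)) ≥ 1 − j, both children 2m
-- and 2m+1 of m have valuation ≥ −(j+1) and exactly one of them has valuation ≥ 1 − (j+1):
-- following that child at every step produces the digits f_s and part (i). Leaving it at
-- position r lands on valuation exactly −r = r − 2r, and from then on the dominant term
-- h₂(m)/4 lowers the valuation by exactly 2 per further digit, which is part (ii).
module Submission where

open import Defs
open import Data.Bool using (Bool; true; false; if_then_else_; not)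
open import Data.Bool.Properties using (¬-not)
open import Data.Nat as ℕ using (ℕ; zero; suc; z≤n; s≤s; _≤_; _<_; _≡ᵇ_)
import Data.Nat.Properties as ℕₚ
import Data.Nat.DivMod as ℕ
import Data.Nat.Tactic.RingSolver as ℕ-Solver
open import Data.Integer as ℤ using (ℤ; +_; +[1+_]; -[1+_]; _-_; _*_; _≥_)
import Data.Integer.Properties as ℤₚ
import Data.Integer.DivMod as ℤ
import Data.Integer.Tactic.RingSolver as ℤ-Solver
open import Data.Rational as ℚ using (ℚ; 0ℚ; 1ℚ; mkℚ; toℚᵘ)
import Data.Rational.Properties as ℚₚ
open import Data.Rational.Solver using (module +-*-Solver)
open import Data.Rational.Unnormalised using (mkℚᵘ; *≡*; _≃_)
import Data.Rational.Unnormalised.Properties as ℚᵘₚ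
open import Data.Nat.Coprimality using (Coprime)
open import Data.List using (applyUpTo)
open import Data.Product using (Σ; _×_; _,_; Σ-syntax; ∃-syntax)
open import Data.Sum using (_⊎_; inj₁; inj₂)
open import Data.Empty using (⊥-elim)
open import Function.Bundles using (_⇔_; mk⇔; Equivalence)
open import Relation.Nullary using (¬_; Dec; yes; no)
open import Relation.Nullary.Decidable using (isYes)
open import Relation.Binary.PropositionalEquality
  using (_≡_; _≢_; refl; sym; trans; cong; cong₂; subst; subst₂; module ≡-Reasoning)

open +-*-Solver using (solve; _:+_; _:*_; _:-_; :-_; _:=_; con)
open ≡-Reasoning

1/[1+_] : ℕ → ℚ
1/[1+ n ] = + 1 ℚ./ suc n

private
  toℚᵘ-/ : ∀ a d → toℚᵘ (a ℚ./ suc d) ≃ mkℚᵘ a d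
  toℚᵘ-/ a d = ℚₚ.toℚᵘ-fromℚᵘ (mkℚᵘ a d)

-- Opaque, so that unification never unfolds the gcd normalisation hidden in ℚ._/_.
opaque
  fromℤ : ℤ → ℚ
  fromℤ a = a ℚ./ 1

  fromℤ-+ : ∀ a b → fromℤ (a ℤ.+ b) ≡ fromℤ a ℚ.+ fromℤ b
  fromℤ-+ a b = ℚₚ.toℚᵘ-injective (ℚᵘₚ.≃-trans (toℚᵘ-/ (a ℤ.+ b) 0) (ℚᵘₚ.≃-sym
    (ℚᵘₚ.≃-trans (ℚₚ.toℚᵘ-homo-+ (fromℤ a) (fromℤ b))
    (ℚᵘₚ.≃-trans (ℚᵘₚ.+-cong (toℚᵘ-/ a 0) (toℚᵘ-/ b 0))
      (*≡* (cong (ℤ._* + 1) (cong₂ ℤ._+_ (ℤₚ.*-identityʳ a) (ℤₚ.*-identityʳ b))))))))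

  fromℤ-* : ∀ a b → fromℤ (a ℤ.* b) ≡ fromℤ a ℚ.* fromℤ b
  fromℤ-* a b = ℚₚ.toℚᵘ-injective (ℚᵘₚ.≃-trans (toℚᵘ-/ (a ℤ.* b) 0) (ℚᵘₚ.≃-sym
    (ℚᵘₚ.≃-trans (ℚₚ.toℚᵘ-homo-* (fromℤ a) (fromℤ b)) (ℚᵘₚ.*-cong (toℚᵘ-/ a 0) (toℚᵘ-/ b 0)))))

  fromℤ-neg : ∀ a → fromℤ (ℤ.- a) ≡ ℚ.- fromℤ a
  fromℤ-neg a = ℚₚ.toℚᵘ-injective (ℚᵘₚ.≃-trans (toℚᵘ-/ (ℤ.- a) 0)
    (ℚᵘₚ.≃-sym (ℚᵘₚ.≃-trans (ℚₚ.toℚᵘ-homo‿- (fromℤ a)) (ℚᵘₚ.-‿cong (toℚᵘ-/ a 0)))))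

  fromℤ-injective : ∀ {a b} → fromℤ a ≡ fromℤ b → a ≡ b
  fromℤ-injective {a} {b} e
    with ℚᵘₚ.≃-trans (ℚᵘₚ.≃-sym (toℚᵘ-/ a 0)) (ℚᵘₚ.≃-trans (ℚₚ.toℚᵘ-cong e) (toℚᵘ-/ b 0))
  ... | *≡* a*1≡b*1 = trans (sym (ℤₚ.*-identityʳ a)) (trans a*1≡b*1 (ℤₚ.*-identityʳ b))

  fromℤ-0 : fromℤ (+ 0) ≡ 0ℚ
  fromℤ-0 = refl

  fromℤ-1 : fromℤ (+ 1) ≡ 1ℚ
  fromℤ-1 = refl

  1/[1+n]*[1+n]≡1 : ∀ n → 1/[1+ n ] ℚ.* fromℤ (+ suc n) ≡ 1ℚ
  1/[1+n]*[1+n]≡1 n = ℚₚ.toℚᵘ-injective (ℚᵘₚ.≃-trans (ℚₚ.toℚᵘ-homo-* 1/[1+ n ] (fromℤ (+ suc n)))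
    (ℚᵘₚ.≃-trans (ℚᵘₚ.*-cong (toℚᵘ-/ (+ 1) n) (toℚᵘ-/ (+ suc n) 0)) (*≡* (cong +_ (ℕₚ.*-assoc 1 (suc n) 1)))))

  mkℚ*denominator : ∀ a d .(c : Coprime ℤ.∣ a ∣ (suc d)) → mkℚ a d c ℚ.* fromℤ (+ suc d) ≡ fromℤ a
  mkℚ*denominator a d c = ℚₚ.toℚᵘ-injective (ℚᵘₚ.≃-trans (ℚₚ.toℚᵘ-homo-* (mkℚ a d c) (fromℤ (+ suc d)))
    (ℚᵘₚ.≃-trans (ℚᵘₚ.*-cong {mkℚᵘ a d} ℚᵘₚ.≃-refl (toℚᵘ-/ (+ suc d) 0))
      (ℚᵘₚ.≃-trans (*≡* (trans (ℤₚ.*-identityʳ _) (cong (a ℤ.*_) (cong +_ (sym (ℕₚ.*-identityʳ (suc d)))))))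
        (ℚᵘₚ.≃-sym (toℚᵘ-/ a 0)))))

fromℕ : ℕ → ℚ
fromℕ n = fromℤ (+ n)

fromℕ-* : ∀ m n → fromℕ (m ℕ.* n) ≡ fromℕ m ℚ.* fromℕ n
fromℕ-* m n = trans (cong fromℤ (ℤₚ.pos-* m n)) (fromℤ-* (+ m) (+ n))

*-cancelʳ-fromℕ-suc : ∀ n {y z} → y ℚ.* fromℕ (suc n) ≡ z ℚ.* fromℕ (suc n) → y ≡ z
*-cancelʳ-fromℕ-suc n {y} {z} e = begin
  y                                ≡⟨ sym (divide y) ⟩
  y ℚ.* fromℕ (suc n) ℚ.* 1/[1+ n ] ≡⟨ cong (ℚ._* 1/[1+ n ]) e ⟩
  z ℚ.* fromℕ (suc n) ℚ.* 1/[1+ n ] ≡⟨ divide z ⟩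
  z                                ∎
  where
  divide : ∀ w → w ℚ.* fromℕ (suc n) ℚ.* 1/[1+ n ] ≡ w
  divide w = trans (ℚₚ.*-assoc w _ _) (trans (cong (w ℚ.*_)
    (trans (ℚₚ.*-comm (fromℕ (suc n)) _) (1/[1+n]*[1+n]≡1 n))) (ℚₚ.*-identityʳ w))

1/[1+]-unique : ∀ n x → x ℚ.* fromℕ (suc n) ≡ 1ℚ → x ≡ 1/[1+ n ]
1/[1+]-unique n x e = *-cancelʳ-fromℕ-suc n
  (trans e (sym (1/[1+n]*[1+n]≡1 n)))

1/[1+]-* : ∀ a b c → suc c ≡ suc a ℕ.* suc b → 1/[1+ c ] ≡ 1/[1+ a ] ℚ.* 1/[1+ b ]
1/[1+]-* a b c e = sym (1/[1+]-unique c _ (begin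
  1/[1+ a ] ℚ.* 1/[1+ b ] ℚ.* fromℕ (suc c)
    ≡⟨ cong (λ n → 1/[1+ a ] ℚ.* 1/[1+ b ] ℚ.* fromℕ n) e ⟩
  1/[1+ a ] ℚ.* 1/[1+ b ] ℚ.* fromℕ (suc a ℕ.* suc b)
    ≡⟨ cong (1/[1+ a ] ℚ.* 1/[1+ b ] ℚ.*_) (fromℕ-* (suc a) (suc b)) ⟩
  1/[1+ a ] ℚ.* 1/[1+ b ] ℚ.* (fromℕ (suc a) ℚ.* fromℕ (suc b))
    ≡⟨ swap 1/[1+ a ] 1/[1+ b ] (fromℕ (suc a)) (fromℕ (suc b)) ⟩
  (1/[1+ a ] ℚ.* fromℕ (suc a)) ℚ.* (1/[1+ b ] ℚ.* fromℕ (suc b))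
    ≡⟨ cong₂ ℚ._*_ (1/[1+n]*[1+n]≡1 a) (1/[1+n]*[1+n]≡1 b) ⟩
  1ℚ ℚ.* 1ℚ
    ≡⟨ ℚₚ.*-identityˡ 1ℚ ⟩
  1ℚ ∎))
  where
  swap : ∀ x y u v → x ℚ.* y ℚ.* (u ℚ.* v) ≡ (x ℚ.* u) ℚ.* (y ℚ.* v)
  swap = solve 4 (λ x y u v → x :* y :* (u :* v) := (x :* u) :* (y :* v)) refl

2^_ : ℕ → ℚ
2^ k = fromℕ (2 ℕ.^ k)

2^-+ : ∀ a b → 2^ (a ℕ.+ b) ≡ 2^ a ℚ.* 2^ b
2^-+ a b = trans (cong fromℕ (ℕₚ.^-distribˡ-+-* 2 a b)) (fromℕ-* _ _)

*-cancelʳ-2^ : ∀ k {y z} → y ℚ.* 2^ k ≡ z ℚ.* 2^ k → y ≡ z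
*-cancelʳ-2^ k {y} {z} e with ℕₚ.m≤n⇒∃[o]m+o≡n (ℕₚ.m^n>0 2 k)
... | m , 1+m≡2^k = *-cancelʳ-fromℕ-suc m (subst (λ n → y ℚ.* fromℕ n ≡ z ℚ.* fromℕ n) (sym 1+m≡2^k) e)

Even Odd : ℤ → Set
Even a = ∃[ k ] a ≡ k ℤ.* + 2
Odd a = ∃[ k ] a ≡ + 1 ℤ.+ k ℤ.* + 2

even-or-odd : ∀ a → Even a ⊎ Odd a
even-or-odd a with a ℤ.%ℕ 2 | ℤ.n%ℕd<d a 2 | ℤ.a≡a%ℕn+[a/ℕn]*n a 2
... | 0           | _             | a≡0+[a/2]*2 = inj₁ (a ℤ./ℕ 2 , trans a≡0+[a/2]*2 (ℤₚ.+-identityˡ _))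
... | 1           | _             | a≡1+[a/2]*2 = inj₂ (a ℤ./ℕ 2 , a≡1+[a/2]*2)
... | suc (suc _) | s≤s (s≤s ()) | _

odd⇒¬even : ∀ {a} → Odd a → ¬ Even a
odd⇒¬even (k , refl) (m , 1+2k≡2m) = ℕₚ.even≢odd ℤ.∣ m ℤ.- k ∣ 0 (begin
  2 ℕ.* ℤ.∣ m ℤ.- k ∣         ≡⟨ ℕₚ.*-comm 2 ℤ.∣ m ℤ.- k ∣ ⟩
  ℤ.∣ m ℤ.- k ∣ ℕ.* 2         ≡⟨ sym (ℤₚ.abs-* (m ℤ.- k) (+ 2)) ⟩
  ℤ.∣ (m ℤ.- k) ℤ.* + 2 ∣     ≡⟨ cong ℤ.∣_∣ (trans (difference m k) (cong (ℤ._- k ℤ.* + 2) (sym 1+2k≡2m))) ⟩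
  ℤ.∣ + 1 ℤ.+ k ℤ.* + 2 ℤ.- k ℤ.* + 2 ∣ ≡⟨ cong ℤ.∣_∣ (cancel k) ⟩
  1                           ∎)
  where
  difference : ∀ m k → (m ℤ.- k) ℤ.* + 2 ≡ m ℤ.* + 2 ℤ.- k ℤ.* + 2
  difference = ℤ-Solver.solve-∀
  cancel : ∀ k → + 1 ℤ.+ k ℤ.* + 2 ℤ.- k ℤ.* + 2 ≡ + 1
  cancel = ℤ-Solver.solve-∀

odd+odd⇒even : ∀ {a b} → Odd a → Odd b → Even (a ℤ.+ b)
odd+odd⇒even (k , refl) (j , refl) = k ℤ.+ j ℤ.+ + 1 , identity k j
  where
  identity : ∀ k j → + 1 ℤ.+ k ℤ.* + 2 ℤ.+ (+ 1 ℤ.+ j ℤ.* + 2) ≡ (k ℤ.+ j ℤ.+ + 1) ℤ.* + 2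
  identity = ℤ-Solver.solve-∀

odd*odd⇒odd : ∀ {a b} → Odd a → Odd b → Odd (a ℤ.* b)
odd*odd⇒odd (k , refl) (j , refl) = k ℤ.+ j ℤ.+ k ℤ.* j ℤ.* + 2 , identity k j
  where
  identity : ∀ k j → (+ 1 ℤ.+ k ℤ.* + 2) ℤ.* (+ 1 ℤ.+ j ℤ.* + 2) ≡ + 1 ℤ.+ (k ℤ.+ j ℤ.+ k ℤ.* j ℤ.* + 2) ℤ.* + 2
  identity = ℤ-Solver.solve-∀

odd-neg : ∀ {a} → Odd a → Odd (ℤ.- a)
odd-neg (k , refl) = ℤ.- k ℤ.- + 1 , identity k
  where
  identity : ∀ k → ℤ.- (+ 1 ℤ.+ k ℤ.* + 2) ≡ + 1 ℤ.+ (ℤ.- k ℤ.- + 1) ℤ.* + 2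
  identity = ℤ-Solver.solve-∀

odd-1+[m*2] : ∀ m → Odd (+ suc (m ℕ.* 2))
odd-1+[m*2] m = + m , trans (ℤₚ.pos-+ 1 (m ℕ.* 2)) (cong (ℤ._+_ (+ 1)) (ℤₚ.pos-* m 2))

-- Lower bounds and exact values of the 2-adic valuation

variable
  p q p′ q′ : ℕ
  x y : ℚ

-- Val≥ p q x encodes ν₂(x) ≥ p − q: x = (num / den) · 2^(p−q) with den odd (x = 0 allowed).
record Val≥ (p q : ℕ) (x : ℚ) : Set where
  constructor val≥
  field
    num den : ℤ
    den-odd : Odd den
    scaled  : x ℚ.* 2^ q ℚ.* fromℤ den ≡ fromℤ num ℚ.* 2^ p

-- Val≡ p q x encodes ν₂(x) = p − q: the numerator is odd as well.
record Val≡ (p q : ℕ) (x : ℚ) : Set where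
  constructor val≡
  field
    lower   : Val≥ p q x
    num-odd : Odd (Val≥.num lower)

open Val≥ using (num)
open Val≡ using (lower)

Val≥-zero : ∀ p q → Val≥ p q 0ℚ
Val≥-zero p q = val≥ (+ 0) (+ 1) (+ 0 , refl)
  (trans (annihilate (2^ q) (fromℤ (+ 1)) (2^ p)) (cong (ℚ._* 2^ p) (sym fromℤ-0)))
  where
  annihilate : ∀ u v w → 0ℚ ℚ.* u ℚ.* v ≡ 0ℚ ℚ.* w
  annihilate = solve 3 (λ u v w → con 0ℚ :* u :* v := con 0ℚ :* w) refl

Val≥-+ : Val≥ p q x → Val≥ p q y → Val≥ p q (x ℚ.+ y)
Val≥-+ {p} {q} {x} {y} (val≥ a d d-odd ex) (val≥ b e e-odd ey) =
  val≥ (a ℤ.* e ℤ.+ b ℤ.* d) (d ℤ.* e) (odd*odd⇒odd d-odd e-odd) (begin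
    (x ℚ.+ y) ℚ.* 2^ q ℚ.* fromℤ (d ℤ.* e)
      ≡⟨ cong ((x ℚ.+ y) ℚ.* 2^ q ℚ.*_) (fromℤ-* d e) ⟩
    (x ℚ.+ y) ℚ.* 2^ q ℚ.* (fromℤ d ℚ.* fromℤ e)
      ≡⟨ expand x y (2^ q) (fromℤ d) (fromℤ e) ⟩
    x ℚ.* 2^ q ℚ.* fromℤ d ℚ.* fromℤ e ℚ.+ y ℚ.* 2^ q ℚ.* fromℤ e ℚ.* fromℤ d
      ≡⟨ cong₂ (λ u v → u ℚ.* fromℤ e ℚ.+ v ℚ.* fromℤ d) ex ey ⟩
    fromℤ a ℚ.* 2^ p ℚ.* fromℤ e ℚ.+ fromℤ b ℚ.* 2^ p ℚ.* fromℤ d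
      ≡⟨ collect (fromℤ a) (fromℤ b) (2^ p) (fromℤ d) (fromℤ e) ⟩
    (fromℤ a ℚ.* fromℤ e ℚ.+ fromℤ b ℚ.* fromℤ d) ℚ.* 2^ p
      ≡⟨ cong (ℚ._* 2^ p) (sym (trans (fromℤ-+ (a ℤ.* e) (b ℤ.* d)) (cong₂ ℚ._+_ (fromℤ-* a e) (fromℤ-* b d)))) ⟩
    fromℤ (a ℤ.* e ℤ.+ b ℤ.* d) ℚ.* 2^ p ∎)
  where
  expand : ∀ x y t u v → (x ℚ.+ y) ℚ.* t ℚ.* (u ℚ.* v) ≡ x ℚ.* t ℚ.* u ℚ.* v ℚ.+ y ℚ.* t ℚ.* v ℚ.* u
  expand = solve 5 (λ x y t u v → (x :+ y) :* t :* (u :* v) := x :* t :* u :* v :+ y :* t :* v :* u) refl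
  collect : ∀ a b t u v → a ℚ.* t ℚ.* v ℚ.+ b ℚ.* t ℚ.* u ≡ (a ℚ.* v ℚ.+ b ℚ.* u) ℚ.* t
  collect = solve 5 (λ a b t u v → a :* t :* v :+ b :* t :* u := (a :* v :+ b :* u) :* t) refl

Val≥-neg : Val≥ p q x → Val≥ p q (ℚ.- x)
Val≥-neg {p} {q} {x} (val≥ a d d-odd e) = val≥ (ℤ.- a) d d-odd (begin
  ℚ.- x ℚ.* 2^ q ℚ.* fromℤ d   ≡⟨ pull-out x (2^ q) (fromℤ d) ⟩
  ℚ.- (x ℚ.* 2^ q ℚ.* fromℤ d) ≡⟨ cong ℚ.-_ e ⟩
  ℚ.- (fromℤ a ℚ.* 2^ p)       ≡⟨ ℚₚ.neg-distribˡ-* (fromℤ a) (2^ p) ⟩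
  ℚ.- fromℤ a ℚ.* 2^ p         ≡⟨ cong (ℚ._* 2^ p) (sym (fromℤ-neg a)) ⟩
  fromℤ (ℤ.- a) ℚ.* 2^ p       ∎)
  where
  pull-out : ∀ x t u → ℚ.- x ℚ.* t ℚ.* u ≡ ℚ.- (x ℚ.* t ℚ.* u)
  pull-out = solve 3 (λ x t u → :- x :* t :* u := :- (x :* t :* u)) refl

Val≥-* : Val≥ p q x → Val≥ p′ q′ y → Val≥ (p ℕ.+ p′) (q ℕ.+ q′) (x ℚ.* y)
Val≥-* {p} {q} {x} {p′} {q′} {y} (val≥ a d d-odd ex) (val≥ b e e-odd ey) =
  val≥ (a ℤ.* b) (d ℤ.* e) (odd*odd⇒odd d-odd e-odd) (begin
    x ℚ.* y ℚ.* 2^ (q ℕ.+ q′) ℚ.* fromℤ (d ℤ.* e)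
      ≡⟨ cong₂ (λ u v → x ℚ.* y ℚ.* u ℚ.* v) (2^-+ q q′) (fromℤ-* d e) ⟩
    x ℚ.* y ℚ.* (2^ q ℚ.* 2^ q′) ℚ.* (fromℤ d ℚ.* fromℤ e)
      ≡⟨ regroup x y (2^ q) (2^ q′) (fromℤ d) (fromℤ e) ⟩
    (x ℚ.* 2^ q ℚ.* fromℤ d) ℚ.* (y ℚ.* 2^ q′ ℚ.* fromℤ e)
      ≡⟨ cong₂ ℚ._*_ ex ey ⟩
    (fromℤ a ℚ.* 2^ p) ℚ.* (fromℤ b ℚ.* 2^ p′)
      ≡⟨ regroup′ (fromℤ a) (fromℤ b) (2^ p) (2^ p′) ⟩
    fromℤ a ℚ.* fromℤ b ℚ.* (2^ p ℚ.* 2^ p′)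
      ≡⟨ sym (cong₂ ℚ._*_ (fromℤ-* a b) (2^-+ p p′)) ⟩
    fromℤ (a ℤ.* b) ℚ.* 2^ (p ℕ.+ p′) ∎)
  where
  regroup : ∀ x y t t′ u v → x ℚ.* y ℚ.* (t ℚ.* t′) ℚ.* (u ℚ.* v) ≡ (x ℚ.* t ℚ.* u) ℚ.* (y ℚ.* t′ ℚ.* v)
  regroup = solve 6 (λ x y t t′ u v → x :* y :* (t :* t′) :* (u :* v) := (x :* t :* u) :* (y :* t′ :* v)) refl
  regroup′ : ∀ a b t t′ → (a ℚ.* t) ℚ.* (b ℚ.* t′) ≡ a ℚ.* b ℚ.* (t ℚ.* t′)
  regroup′ = solve 4 (λ a b t t′ → (a :* t) :* (b :* t′) := a :* b :* (t :* t′)) refl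

Val≥-mono : Val≥ p q x → p′ ℕ.+ q ≤ p ℕ.+ q′ → Val≥ p′ q′ x
Val≥-mono {p} {q} {x} {p′} {q′} (val≥ a d d-odd e) le with ℕₚ.m≤n⇒∃[o]m+o≡n le
... | k , p′+q+k≡p+q′ = val≥ (a ℤ.* + (2 ℕ.^ k)) d d-odd (*-cancelʳ-2^ q (begin
  x ℚ.* 2^ q′ ℚ.* fromℤ d ℚ.* 2^ q     ≡⟨ swap x (2^ q′) (fromℤ d) (2^ q) ⟩
  x ℚ.* 2^ q ℚ.* fromℤ d ℚ.* 2^ q′     ≡⟨ cong (ℚ._* 2^ q′) e ⟩
  fromℤ a ℚ.* 2^ p ℚ.* 2^ q′           ≡⟨ ℚₚ.*-assoc (fromℤ a) (2^ p) (2^ q′) ⟩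
  fromℤ a ℚ.* (2^ p ℚ.* 2^ q′)         ≡⟨ cong (fromℤ a ℚ.*_) (sym (2^-+ p q′)) ⟩
  fromℤ a ℚ.* 2^ (p ℕ.+ q′)            ≡⟨ cong (λ n → fromℤ a ℚ.* 2^ n) (sym p′+q+k≡p+q′) ⟩
  fromℤ a ℚ.* 2^ (p′ ℕ.+ q ℕ.+ k)      ≡⟨ cong (fromℤ a ℚ.*_) (trans (2^-+ (p′ ℕ.+ q) k)
                                                                 (cong (ℚ._* 2^ k) (2^-+ p′ q))) ⟩
  fromℤ a ℚ.* (2^ p′ ℚ.* 2^ q ℚ.* 2^ k) ≡⟨ regroup (fromℤ a) (2^ p′) (2^ q) (2^ k) ⟩
  fromℤ a ℚ.* 2^ k ℚ.* 2^ p′ ℚ.* 2^ q   ≡⟨ cong (λ u → u ℚ.* 2^ p′ ℚ.* 2^ q) (sym (fromℤ-* a (+ (2 ℕ.^ k)))) ⟩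
  fromℤ (a ℤ.* + (2 ℕ.^ k)) ℚ.* 2^ p′ ℚ.* 2^ q ∎))
  where
  swap : ∀ x t u t′ → x ℚ.* t ℚ.* u ℚ.* t′ ≡ x ℚ.* t′ ℚ.* u ℚ.* t
  swap = solve 4 (λ x t u t′ → x :* t :* u :* t′ := x :* t′ :* u :* t) refl
  regroup : ∀ a t t′ s → a ℚ.* (t ℚ.* t′ ℚ.* s) ≡ a ℚ.* s ℚ.* t ℚ.* t′
  regroup = solve 4 (λ a t t′ s → a :* (t :* t′ :* s) := a :* s :* t :* t′) refl

Val≥-even : (v : Val≥ p q x) → Even (num v) → Val≥ (suc p) q x
Val≥-even {p} {q} {x} (val≥ _ d d-odd e) (k , refl) = val≥ k d d-odd (begin
  x ℚ.* 2^ q ℚ.* fromℤ d                  ≡⟨ e ⟩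
  fromℤ (k ℤ.* + 2) ℚ.* 2^ p              ≡⟨ cong (ℚ._* 2^ p) (fromℤ-* k (+ 2)) ⟩
  fromℤ k ℚ.* fromℤ (+ 2) ℚ.* 2^ p        ≡⟨ ℚₚ.*-assoc (fromℤ k) (fromℤ (+ 2)) (2^ p) ⟩
  fromℤ k ℚ.* (fromℤ (+ 2) ℚ.* 2^ p)      ≡⟨ cong (fromℤ k ℚ.*_) (sym (2^-+ 1 p)) ⟩
  fromℤ k ℚ.* 2^ (suc p)                  ∎)

Val≥-odd⇒¬Val≥-suc : (v : Val≥ p q x) → Odd (num v) → ¬ Val≥ (suc p) q x
Val≥-odd⇒¬Val≥-suc {p} {q} {x} (val≥ a d _ ex) a-odd (val≥ b e e-odd ey) =
  odd⇒¬even (odd*odd⇒odd a-odd e-odd) (b ℤ.* d , fromℤ-injective (*-cancelʳ-2^ p (begin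
    fromℤ (a ℤ.* e) ℚ.* 2^ p                       ≡⟨ cong (ℚ._* 2^ p) (fromℤ-* a e) ⟩
    fromℤ a ℚ.* fromℤ e ℚ.* 2^ p                   ≡⟨ swap (fromℤ a) (fromℤ e) (2^ p) ⟩
    fromℤ a ℚ.* 2^ p ℚ.* fromℤ e                   ≡⟨ cong (ℚ._* fromℤ e) (sym ex) ⟩
    x ℚ.* 2^ q ℚ.* fromℤ d ℚ.* fromℤ e             ≡⟨ swap (x ℚ.* 2^ q) (fromℤ d) (fromℤ e) ⟩
    x ℚ.* 2^ q ℚ.* fromℤ e ℚ.* fromℤ d             ≡⟨ cong (ℚ._* fromℤ d) ey ⟩
    fromℤ b ℚ.* 2^ (suc p) ℚ.* fromℤ d             ≡⟨ cong (λ t → fromℤ b ℚ.* t ℚ.* fromℤ d) (2^-+ 1 p) ⟩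
    fromℤ b ℚ.* (fromℤ (+ 2) ℚ.* 2^ p) ℚ.* fromℤ d ≡⟨ regroup (fromℤ b) (fromℤ (+ 2)) (2^ p) (fromℤ d) ⟩
    fromℤ b ℚ.* fromℤ d ℚ.* fromℤ (+ 2) ℚ.* 2^ p   ≡⟨ cong (ℚ._* 2^ p) (sym (trans (fromℤ-* (b ℤ.* d) (+ 2))
                                                                              (cong (ℚ._* fromℤ (+ 2)) (fromℤ-* b d)))) ⟩
    fromℤ (b ℤ.* d ℤ.* + 2) ℚ.* 2^ p               ∎)))
  where
  swap : ∀ u v w → u ℚ.* v ℚ.* w ≡ u ℚ.* w ℚ.* v
  swap = solve 3 (λ u v w → u :* v :* w := u :* w :* v) refl
  regroup : ∀ b t s d → b ℚ.* (t ℚ.* s) ℚ.* d ≡ b ℚ.* d ℚ.* t ℚ.* s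
  regroup = solve 4 (λ b t s d → b :* (t :* s) :* d := b :* d :* t :* s) refl

Val≡⇒¬Val≥-suc : Val≡ p q x → ¬ Val≥ (suc p) q x
Val≡⇒¬Val≥-suc (val≡ v num-odd) = Val≥-odd⇒¬Val≥-suc v num-odd

Val≥∧¬Val≥-suc⇒Val≡ : Val≥ p q x → ¬ Val≥ (suc p) q x → Val≡ p q x
Val≥∧¬Val≥-suc⇒Val≡ v ¬w with even-or-odd (num v)
... | inj₁ num-even = ⊥-elim (¬w (Val≥-even v num-even))
... | inj₂ num-odd  = val≡ v num-odd

Val≥∧¬Val≡⇒Val≥-suc : Val≥ p q x → ¬ Val≡ p q x → Val≥ (suc p) q x
Val≥∧¬Val≡⇒Val≥-suc v ¬u with even-or-odd (num v)
... | inj₁ num-even = Val≥-even v num-even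
... | inj₂ num-odd  = ⊥-elim (¬u (val≡ v num-odd))

Val≡-Val≥⇒≤ : Val≡ p q x → Val≥ p′ q′ x → p′ ℕ.+ q ≤ p ℕ.+ q′
Val≡-Val≥⇒≤ {p} {q} {x} {p′} {q′} u v with p′ ℕ.+ q ℕ.≤? p ℕ.+ q′
... | yes le = le
... | no ¬le = ⊥-elim (Val≡⇒¬Val≥-suc u (Val≥-mono v (ℕₚ.≰⇒> ¬le)))

Val≡-zero : ¬ Val≡ p q 0ℚ
Val≡-zero {p} {q} u = Val≡⇒¬Val≥-suc u (Val≥-zero (suc p) q)

Val≡-mono : Val≡ p q x → p′ ℕ.+ q ≡ p ℕ.+ q′ → Val≡ p′ q′ x
Val≡-mono u eq = Val≥∧¬Val≥-suc⇒Val≡ (Val≥-mono (lower u) (ℕₚ.≤-reflexive eq))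
  (λ w → Val≡⇒¬Val≥-suc u (Val≥-mono w (s≤s (ℕₚ.≤-reflexive (sym eq)))))

Val≡-neg : Val≡ p q x → Val≡ p q (ℚ.- x)
Val≡-neg (val≡ v num-odd) = val≡ (Val≥-neg v) (odd-neg num-odd)

Val≡-* : Val≡ p q x → Val≡ p′ q′ y → Val≡ (p ℕ.+ p′) (q ℕ.+ q′) (x ℚ.* y)
Val≡-* (val≡ v a-odd) (val≡ w b-odd) = val≡ (Val≥-* v w) (odd*odd⇒odd a-odd b-odd)

Val≡-+-Val≡ : Val≡ p q x → Val≡ p q y → Val≥ (suc p) q (x ℚ.+ y)
Val≡-+-Val≡ (val≡ v a-odd) (val≡ w b-odd) = Val≥-even (Val≥-+ v w)
  (odd+odd⇒even (odd*odd⇒odd a-odd (Val≥.den-odd w)) (odd*odd⇒odd b-odd (Val≥.den-odd v)))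

Val≡-+-Val≥ : Val≡ p q x → Val≥ (suc p) q y → Val≡ p q (x ℚ.+ y)
Val≡-+-Val≥ {p} {q} {x} {y} u w = Val≥∧¬Val≥-suc⇒Val≡
  (Val≥-+ (lower u) (Val≥-mono w (ℕₚ.n≤1+n (p ℕ.+ q))))
  (λ v → Val≡⇒¬Val≥-suc u (subst (Val≥ (suc p) q) (cancel x y) (Val≥-+ v (Val≥-neg w))))
  where
  cancel : ∀ x y → x ℚ.+ y ℚ.+ ℚ.- y ≡ x
  cancel = solve 2 (λ x y → x :+ y :+ :- y := x) refl

ℕ-parity : ∀ n → ∃[ j ] (n ≡ j ℕ.* 2 ⊎ n ≡ suc (j ℕ.* 2))
ℕ-parity n with n ℕ.% 2 | ℕ.m%n<n n 2 | ℕ.m≡m%n+[m/n]*n n 2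
... | 0           | _            | n≡[n/2]*2   = n ℕ./ 2 , inj₁ n≡[n/2]*2
... | 1           | _            | n≡1+[n/2]*2 = n ℕ./ 2 , inj₂ n≡1+[n/2]*2
... | suc (suc _) | s≤s (s≤s ()) | _

[1+m*2]%2≡1 : ∀ m → suc (m ℕ.* 2) ℕ.% 2 ≡ 1
[1+m*2]%2≡1 m = ℕ.[m+kn]%n≡m%n 1 m 2

[1+m]*2%2≡0 : ∀ m → suc m ℕ.* 2 ℕ.% 2 ≡ 0
[1+m]*2%2≡0 m = ℕ.m*n%n≡0 (suc m) 2

[1+m]*2/2≡1+m : ∀ m → suc m ℕ.* 2 ℕ./ 2 ≡ suc m
[1+m]*2/2≡1+m m = ℕ.m*n/n≡m (suc m) 2

ν₂ℕ-go-odd : ∀ k j → ν₂ℕ-go (suc k) (suc (j ℕ.* 2)) ≡ 0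
ν₂ℕ-go-odd k j rewrite [1+m*2]%2≡1 j = refl

ν₂ℕ-go-even : ∀ k j → ν₂ℕ-go (suc k) (suc j ℕ.* 2) ≡ suc (ν₂ℕ-go k (suc j))
ν₂ℕ-go-even k j rewrite [1+m]*2%2≡0 j | [1+m]*2/2≡1+m j = refl

ν₂ℕ-go-decomposition : ∀ k n → n < k → ∃[ o ] suc n ≡ 2 ℕ.^ ν₂ℕ-go k (suc n) ℕ.* suc (o ℕ.* 2)
ν₂ℕ-go-decomposition (suc k) n n<1+k with ℕ-parity (suc n)
... | j     , inj₂ refl = j , sym (trans (cong (λ v → 2 ℕ.^ v ℕ.* suc (j ℕ.* 2)) (ν₂ℕ-go-odd k j))
                                         (ℕₚ.*-identityˡ (suc (j ℕ.* 2))))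
... | suc j , inj₁ refl with ν₂ℕ-go-decomposition k j (ℕₚ.<-≤-trans (s≤s (ℕₚ.m≤m*n j 2)) (ℕₚ.≤-pred n<1+k))
...   | o , 1+j≡2^v*odd = o , (begin
  suc j ℕ.* 2                           ≡⟨ cong (ℕ._* 2) 1+j≡2^v*odd ⟩
  2 ℕ.^ v ℕ.* odd ℕ.* 2                 ≡⟨ rotate (2 ℕ.^ v) odd ⟩
  2 ℕ.^ suc v ℕ.* odd                   ≡⟨ cong (λ w → 2 ℕ.^ w ℕ.* odd) (sym (ν₂ℕ-go-even k j)) ⟩
  2 ℕ.^ ν₂ℕ-go (suc k) (suc j ℕ.* 2) ℕ.* odd ∎)
  where
  v odd : ℕ
  v = ν₂ℕ-go k (suc j)
  odd = suc (o ℕ.* 2)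
  rotate : ∀ t u → t ℕ.* u ℕ.* 2 ≡ 2 ℕ.* t ℕ.* u
  rotate = ℕ-Solver.solve-∀

ν₂ℕ-decomposition : ∀ n → ∃[ o ] suc n ≡ 2 ℕ.^ ν₂ℕ (suc n) ℕ.* suc (o ℕ.* 2)
ν₂ℕ-decomposition n = ν₂ℕ-go-decomposition (suc n) n (ℕₚ.n<1+n n)

odd-factorization : ∀ a k → ℤ.∣ a ∣ ≡ suc k → ∃[ b ] Odd b × a ≡ b ℤ.* + (2 ℕ.^ ν₂ℕ (suc k))
odd-factorization a k ∣a∣≡1+k with ν₂ℕ-decomposition k
... | o , 1+k≡2^v*odd = signed a ∣a∣≡1+k
  where
  odd 2^v : ℕ
  odd = suc (o ℕ.* 2)
  2^v = 2 ℕ.^ ν₂ℕ (suc k)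
  1+k≡odd*2^v : + suc k ≡ + odd ℤ.* + 2^v
  1+k≡odd*2^v = trans (cong +_ (trans 1+k≡2^v*odd (ℕₚ.*-comm 2^v odd))) (ℤₚ.pos-* odd 2^v)
  signed : ∀ a → ℤ.∣ a ∣ ≡ suc k → ∃[ b ] Odd b × a ≡ b ℤ.* + 2^v
  signed (+ _)     refl = + odd , odd-1+[m*2] o , 1+k≡odd*2^v
  signed -[1+ _ ] refl = ℤ.- + odd , odd-neg (odd-1+[m*2] o) ,
    trans (cong ℤ.-_ 1+k≡odd*2^v) (ℤₚ.neg-distribˡ-* (+ odd) (+ 2^v))

Val≡-mkℚ : ∀ a k d .(c : Coprime ℤ.∣ a ∣ (suc d)) → ℤ.∣ a ∣ ≡ suc k →
           Val≡ (ν₂ℕ (suc k)) (ν₂ℕ (suc d)) (mkℚ a d c)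
Val≡-mkℚ a k d c ∣a∣≡1+k with odd-factorization a k ∣a∣≡1+k | ν₂ℕ-decomposition d
... | b , b-odd , a≡b*2^v | o , 1+d≡2^w*odd = val≡ (val≥ b (+ odd) (odd-1+[m*2] o) (begin
  mkℚ a d c ℚ.* 2^ w ℚ.* fromℕ odd   ≡⟨ ℚₚ.*-assoc (mkℚ a d c) (2^ w) (fromℕ odd) ⟩
  mkℚ a d c ℚ.* (2^ w ℚ.* fromℕ odd) ≡⟨ cong (mkℚ a d c ℚ.*_) (sym (trans (cong fromℕ 1+d≡2^w*odd)
                                                                           (fromℕ-* (2 ℕ.^ w) odd))) ⟩
  mkℚ a d c ℚ.* fromℕ (suc d)         ≡⟨ mkℚ*denominator a d c ⟩
  fromℤ a                              ≡⟨ cong fromℤ a≡b*2^v ⟩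
  fromℤ (b ℤ.* + (2 ℕ.^ ν₂ℕ (suc k)))  ≡⟨ fromℤ-* b (+ (2 ℕ.^ ν₂ℕ (suc k))) ⟩
  fromℤ b ℚ.* 2^ ν₂ℕ (suc k)           ∎)) b-odd
  where
  w odd : ℕ
  w = ν₂ℕ (suc d)
  odd = suc (o ℕ.* 2)

Val≡-ν₂ℕ : ∀ x → x ≢ 0ℚ → Val≡ (ν₂ℕ ℤ.∣ ℚ.↥ x ∣) (ν₂ℕ (ℚ.↧ₙ x)) x
Val≡-ν₂ℕ x@(mkℚ (+ 0)        _ _) x≢0 = ⊥-elim (x≢0 (ℚₚ.↥p≡0⇒p≡0 x refl))
Val≡-ν₂ℕ   (mkℚ a@(+[1+ k ]) d c) _   = Val≡-mkℚ a k d c refl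
Val≡-ν₂ℕ   (mkℚ a@(-[1+ k ]) d c) _   = Val≡-mkℚ a k d c refl

m-n≤o-p⇔m+p≤o+n : ∀ m n o p → (+ m ℤ.- + n ℤ.≤ + o ℤ.- + p) ⇔ (m ℕ.+ p ≤ o ℕ.+ n)
m-n≤o-p⇔m+p≤o+n m n o p = mk⇔
  (λ le → ℤₚ.drop‿+≤+ (subst₂ ℤ._≤_
    (trans (cancelˡ (+ m) (+ n) (+ p)) (sym (ℤₚ.pos-+ m p)))
    (trans (cancelʳ (+ o) (+ n) (+ p)) (sym (ℤₚ.pos-+ o n)))
    (ℤₚ.+-monoˡ-≤ (+ n ℤ.+ + p) le)))
  (λ le → subst₂ ℤ._≤_
    (trans (cong (ℤ._+ c) (ℤₚ.pos-+ m p)) (restoreˡ (+ m) (+ n) (+ p)))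
    (trans (cong (ℤ._+ c) (ℤₚ.pos-+ o n)) (restoreʳ (+ o) (+ n) (+ p)))
    (ℤₚ.+-monoˡ-≤ c (ℤ.+≤+ le)))
  where
  c : ℤ
  c = ℤ.- + n ℤ.- + p
  cancelˡ : ∀ a b c → a ℤ.- b ℤ.+ (b ℤ.+ c) ≡ a ℤ.+ c
  cancelˡ = ℤ-Solver.solve-∀
  cancelʳ : ∀ a b c → a ℤ.- c ℤ.+ (b ℤ.+ c) ≡ a ℤ.+ b
  cancelʳ = ℤ-Solver.solve-∀
  restoreˡ : ∀ a b c → a ℤ.+ c ℤ.+ (ℤ.- b ℤ.- c) ≡ a ℤ.- b
  restoreˡ = ℤ-Solver.solve-∀
  restoreʳ : ∀ a b c → a ℤ.+ b ℤ.+ (ℤ.- b ℤ.- c) ≡ a ℤ.- c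
  restoreʳ = ℤ-Solver.solve-∀

ν₂-Val≡ : Val≡ p q x → ν₂ x ≡ + p ℤ.- + q
ν₂-Val≡ {p} {q} {x} u = ℤₚ.≤-antisym
  (Equivalence.from (m-n≤o-p⇔m+p≤o+n _ _ p q) (Val≡-Val≥⇒≤ u (lower exact)))
  (Equivalence.from (m-n≤o-p⇔m+p≤o+n p q _ _) (Val≡-Val≥⇒≤ exact (lower u)))
  where
  exact : Val≡ (ν₂ℕ ℤ.∣ ℚ.↥ x ∣) (ν₂ℕ (ℚ.↧ₙ x)) x
  exact = Val≡-ν₂ℕ x (λ x≡0 → Val≡-zero (subst (Val≡ p q) x≡0 u))

-- p ≤ q is needed only for x = 0, where ν₂ takes the junk value 0.
ν₂-Val≥ : p ≤ q → Val≥ p q x → + p ℤ.- + q ℤ.≤ ν₂ x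
ν₂-Val≥ {p} {q} {x} p≤q v with x ℚ.≟ 0ℚ
... | yes refl = Equivalence.from (m-n≤o-p⇔m+p≤o+n p q 0 0) (subst (_≤ q) (sym (ℕₚ.+-identityʳ p)) p≤q)
... | no x≢0   = Equivalence.from (m-n≤o-p⇔m+p≤o+n p q _ _) (Val≡-Val≥⇒≤ (Val≡-ν₂ℕ x x≢0) v)

Val≥-ν₂ : + p ℤ.- + q ℤ.≤ ν₂ x → Val≥ p q x
Val≥-ν₂ {p} {q} {x} le with x ℚ.≟ 0ℚ
... | yes refl = Val≥-zero p q
... | no x≢0   = Val≥-mono (lower (Val≡-ν₂ℕ x x≢0)) (Equivalence.to (m-n≤o-p⇔m+p≤o+n p q _ _) le)

-- The harmonic sums H_n and H(n,2)

harmonic : ℕ → ℚ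
harmonic zero    = 0ℚ
harmonic (suc n) = harmonic n ℚ.+ 1/[1+ n ]

harmonic₂ : ℕ → ℚ
harmonic₂ zero    = 0ℚ
harmonic₂ (suc n) = harmonic₂ n ℚ.+ harmonic n ℚ.* 1/[1+ n ]

sumℚ-applyUpTo-suc : ∀ (f : ℕ → ℚ) n → sumℚ (applyUpTo f (suc n)) ≡ sumℚ (applyUpTo f n) ℚ.+ f n
sumℚ-applyUpTo-suc f zero    = trans (ℚₚ.+-identityʳ (f 0)) (sym (ℚₚ.+-identityˡ (f 0)))
sumℚ-applyUpTo-suc f (suc n) = trans (cong (f 0 ℚ.+_) (sumℚ-applyUpTo-suc (λ t → f (suc t)) n))
                                     (sym (ℚₚ.+-assoc (f 0) _ (f (suc n))))

sumℚ-applyUpTo-cong : ∀ (f g : ℕ → ℚ) n → (∀ t → t < n → f t ≡ g t) →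
                      sumℚ (applyUpTo f n) ≡ sumℚ (applyUpTo g n)
sumℚ-applyUpTo-cong f g zero    f≗g = refl
sumℚ-applyUpTo-cong f g (suc n) f≗g = begin
  sumℚ (applyUpTo f (suc n))        ≡⟨ sumℚ-applyUpTo-suc f n ⟩
  sumℚ (applyUpTo f n) ℚ.+ f n      ≡⟨ cong₂ ℚ._+_ (sumℚ-applyUpTo-cong f g n (λ t t<n → f≗g t (ℕₚ.m<n⇒m<1+n t<n)))
                                                  (f≗g n (ℕₚ.n<1+n n)) ⟩
  sumℚ (applyUpTo g n) ℚ.+ g n      ≡⟨ sym (sumℚ-applyUpTo-suc g n) ⟩
  sumℚ (applyUpTo g (suc n))        ∎

Hfrom-1 : ∀ l n → l ≤ n → Hfrom 1 l n ≡ harmonic n ℚ.- harmonic l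
Hfrom-1 l n l≤n with ℕₚ.m≤n⇒∃[o]m+o≡n l≤n
... | m , refl = trans (cong (λ k → sumℚ (applyUpTo (λ t → 1/[1+ l ℕ.+ t ] ℚ.* 1ℚ) k)) (ℕₚ.m+n∸m≡n l m))
                       (partial-sum m)
  where
  partial-sum : ∀ m → sumℚ (applyUpTo (λ t → 1/[1+ l ℕ.+ t ] ℚ.* 1ℚ) m) ≡ harmonic (l ℕ.+ m) ℚ.- harmonic l
  partial-sum zero    = trans (sym (ℚₚ.+-inverseʳ (harmonic l)))
                              (cong (λ k → harmonic k ℚ.- harmonic l) (sym (ℕₚ.+-identityʳ l)))
  partial-sum (suc m) = begin
    sumℚ (applyUpTo (λ t → 1/[1+ l ℕ.+ t ] ℚ.* 1ℚ) (suc m))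
      ≡⟨ sumℚ-applyUpTo-suc (λ t → 1/[1+ l ℕ.+ t ] ℚ.* 1ℚ) m ⟩
    sumℚ (applyUpTo (λ t → 1/[1+ l ℕ.+ t ] ℚ.* 1ℚ) m) ℚ.+ 1/[1+ l ℕ.+ m ] ℚ.* 1ℚ
      ≡⟨ cong₂ ℚ._+_ (partial-sum m) (ℚₚ.*-identityʳ 1/[1+ l ℕ.+ m ]) ⟩
    harmonic (l ℕ.+ m) ℚ.- harmonic l ℚ.+ 1/[1+ l ℕ.+ m ]
      ≡⟨ reorder (harmonic (l ℕ.+ m)) (harmonic l) 1/[1+ l ℕ.+ m ] ⟩
    harmonic (suc (l ℕ.+ m)) ℚ.- harmonic l
      ≡⟨ cong (λ k → harmonic k ℚ.- harmonic l) (sym (ℕₚ.+-suc l m)) ⟩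
    harmonic (l ℕ.+ suc m) ℚ.- harmonic l ∎
    where
    reorder : ∀ a b c → a ℚ.- b ℚ.+ c ≡ a ℚ.+ c ℚ.- b
    reorder = solve 3 (λ a b c → a :- b :+ c := a :+ c :- b) refl

-- Keeping the constant c (later H_n) general is what makes the induction on n go through.
tail-sum : ∀ n c → sumℚ (applyUpTo (λ t → 1/[1+ t ] ℚ.* (c ℚ.- harmonic (suc t))) n)
                   ≡ (c ℚ.- harmonic n) ℚ.* harmonic n ℚ.+ harmonic₂ n
tail-sum zero    c = sym (annihilate c)
  where
  annihilate : ∀ c → (c ℚ.- 0ℚ) ℚ.* 0ℚ ℚ.+ 0ℚ ≡ 0ℚ
  annihilate = solve 1 (λ c → (c :- con 0ℚ) :* con 0ℚ :+ con 0ℚ := con 0ℚ) refl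
tail-sum (suc n) c = begin
  sumℚ (applyUpTo term (suc n))                 ≡⟨ sumℚ-applyUpTo-suc term n ⟩
  sumℚ (applyUpTo term n) ℚ.+ term n            ≡⟨ cong (ℚ._+ term n) (tail-sum n c) ⟩
  (c ℚ.- harmonic n) ℚ.* harmonic n ℚ.+ harmonic₂ n ℚ.+ 1/[1+ n ] ℚ.* (c ℚ.- (harmonic n ℚ.+ 1/[1+ n ]))
    ≡⟨ expand c (harmonic n) (harmonic₂ n) 1/[1+ n ] ⟩
  (c ℚ.- (harmonic n ℚ.+ 1/[1+ n ])) ℚ.* (harmonic n ℚ.+ 1/[1+ n ]) ℚ.+ (harmonic₂ n ℚ.+ harmonic n ℚ.* 1/[1+ n ]) ∎
  where
  term : ℕ → ℚ
  term t = 1/[1+ t ] ℚ.* (c ℚ.- harmonic (suc t))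
  expand : ∀ c h h₂ r → (c ℚ.- h) ℚ.* h ℚ.+ h₂ ℚ.+ r ℚ.* (c ℚ.- (h ℚ.+ r))
                       ≡ (c ℚ.- (h ℚ.+ r)) ℚ.* (h ℚ.+ r) ℚ.+ (h₂ ℚ.+ h ℚ.* r)
  expand = solve 4 (λ c h h₂ r → (c :- h) :* h :+ h₂ :+ r :* (c :- (h :+ r))
                               := (c :- (h :+ r)) :* (h :+ r) :+ (h₂ :+ h :* r)) refl

H≡harmonic₂ : ∀ n → H n 2 ≡ harmonic₂ n
H≡harmonic₂ n = begin
  H n 2
    ≡⟨ sumℚ-applyUpTo-cong _ (λ t → 1/[1+ t ] ℚ.* (harmonic n ℚ.- harmonic (suc t))) n
         (λ t t<n → cong (1/[1+ t ] ℚ.*_) (Hfrom-1 (suc t) n t<n)) ⟩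
  sumℚ (applyUpTo (λ t → 1/[1+ t ] ℚ.* (harmonic n ℚ.- harmonic (suc t))) n)
    ≡⟨ tail-sum n (harmonic n) ⟩
  (harmonic n ℚ.- harmonic n) ℚ.* harmonic n ℚ.+ harmonic₂ n
    ≡⟨ vanish (harmonic n) (harmonic₂ n) ⟩
  harmonic₂ n ∎
  where
  vanish : ∀ h h₂ → (h ℚ.- h) ℚ.* h ℚ.+ h₂ ≡ h₂
  vanish = solve 2 (λ h h₂ → (h :- h) :* h :+ h₂ := h₂) refl

-- 2-adic valuations of harmonic sums

2^s≤2^[1+s] : ∀ s → 2 ℕ.^ s ≤ 2 ℕ.^ suc s
2^s≤2^[1+s] s = ℕₚ.m≤m+n (2 ℕ.^ s) (2 ℕ.^ s ℕ.+ 0)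

2^s*w≡2^s : ∀ s w → 0 < 2 ℕ.^ s ℕ.* w → 2 ℕ.^ s ℕ.* w < 2 ℕ.^ suc s → 2 ℕ.^ s ℕ.* w ≡ 2 ℕ.^ s
2^s*w≡2^s s zero          pos _ = ⊥-elim (ℕₚ.<-irrefl (sym (ℕₚ.*-zeroʳ (2 ℕ.^ s))) pos)
2^s*w≡2^s s (suc zero)    _   _ = ℕₚ.*-identityʳ (2 ℕ.^ s)
2^s*w≡2^s s (suc (suc w)) _   upper = ⊥-elim (ℕₚ.<⇒≱ upper
  (ℕₚ.≤-trans (ℕₚ.≤-reflexive (ℕₚ.*-comm 2 (2 ℕ.^ s))) (ℕₚ.*-monoʳ-≤ (2 ℕ.^ s) (s≤s (s≤s z≤n)))))

1/[1+]-Val≡ : ∀ n v o → suc n ≡ 2 ℕ.^ v ℕ.* suc (o ℕ.* 2) → Val≡ 0 v 1/[1+ n ]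
1/[1+]-Val≡ n v o 1+n≡2^v*odd = val≡ (val≥ (+ 1) (+ suc (o ℕ.* 2)) (odd-1+[m*2] o) (begin
  1/[1+ n ] ℚ.* 2^ v ℚ.* fromℕ (suc (o ℕ.* 2))   ≡⟨ ℚₚ.*-assoc 1/[1+ n ] (2^ v) _ ⟩
  1/[1+ n ] ℚ.* (2^ v ℚ.* fromℕ (suc (o ℕ.* 2))) ≡⟨ cong (1/[1+ n ] ℚ.*_) (sym (trans (cong fromℕ 1+n≡2^v*odd)
                                                                                    (fromℕ-* _ _))) ⟩
  1/[1+ n ] ℚ.* fromℕ (suc n)                     ≡⟨ 1/[1+n]*[1+n]≡1 n ⟩
  1ℚ                                              ≡⟨ sym (trans (cong₂ ℚ._*_ fromℤ-1 fromℤ-1) (ℚₚ.*-identityˡ 1ℚ)) ⟩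
  fromℤ (+ 1) ℚ.* 2^ 0                            ∎)) (+ 0 , refl)

1/[1+2m]-Val≡ : ∀ m → Val≡ 0 0 1/[1+ 2 ℕ.* m ]
1/[1+2m]-Val≡ m = 1/[1+]-Val≡ (2 ℕ.* m) 0 m
  (cong suc (trans (ℕₚ.*-comm 2 m) (sym (ℕₚ.+-identityʳ (m ℕ.* 2)))))

½-Val≡ : Val≡ 0 1 1/[1+ 1 ]
½-Val≡ = 1/[1+]-Val≡ 1 1 0 refl

1/[1+]-Val≥ : ∀ n s → suc n < 2 ℕ.^ suc s → suc n ≢ 2 ℕ.^ s → Val≥ 1 s 1/[1+ n ]
1/[1+]-Val≥ n s upper ≢2^s with ν₂ℕ-decomposition n
... | o , 1+n≡2^v*odd with ν₂ℕ (suc n) ℕ.<? s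
...   | yes v<s = Val≥-mono (lower (1/[1+]-Val≡ n _ o 1+n≡2^v*odd)) v<s
...   | no v≮s with ℕₚ.m≤n⇒∃[o]m+o≡n (ℕₚ.≮⇒≥ v≮s)
...     | t , s+t≡v = ⊥-elim (≢2^s (trans 1+n≡2^s*w (2^s*w≡2^s s w (subst (0 <_) 1+n≡2^s*w (s≤s z≤n))
                                                       (subst (_< 2 ℕ.^ suc s) 1+n≡2^s*w upper))))
  where
  w : ℕ
  w = 2 ℕ.^ t ℕ.* suc (o ℕ.* 2)
  1+n≡2^s*w : suc n ≡ 2 ℕ.^ s ℕ.* w
  1+n≡2^s*w = begin
    suc n                                          ≡⟨ 1+n≡2^v*odd ⟩
    2 ℕ.^ ν₂ℕ (suc n) ℕ.* suc (o ℕ.* 2)           ≡⟨ cong (λ e → 2 ℕ.^ e ℕ.* suc (o ℕ.* 2)) (sym s+t≡v) ⟩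
    2 ℕ.^ (s ℕ.+ t) ℕ.* suc (o ℕ.* 2)             ≡⟨ cong (ℕ._* suc (o ℕ.* 2)) (ℕₚ.^-distribˡ-+-* 2 s t) ⟩
    2 ℕ.^ s ℕ.* 2 ℕ.^ t ℕ.* suc (o ℕ.* 2)         ≡⟨ ℕₚ.*-assoc (2 ℕ.^ s) (2 ℕ.^ t) _ ⟩
    2 ℕ.^ s ℕ.* w                                  ∎

1/[1+]-Val≥-below : ∀ n s → suc n < 2 ℕ.^ s → Val≥ 1 s 1/[1+ n ]
1/[1+]-Val≥-below n s upper = 1/[1+]-Val≥ n s (ℕₚ.<-≤-trans upper (2^s≤2^[1+s] s)) (ℕₚ.<⇒≢ upper)

harmonic-Val≥ : ∀ s n → n < 2 ℕ.^ s → Val≥ 1 s (harmonic n)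
harmonic-Val≥ s zero    _ = Val≥-zero 1 s
harmonic-Val≥ s (suc n) upper = Val≥-+ (harmonic-Val≥ s n (ℕₚ.<-trans (ℕₚ.n<1+n n) upper)) (1/[1+]-Val≥-below n s upper)

-- Between 2^s and 2^(s+1) the term 1/2^s is the only one of valuation −s.
harmonic-Val≡ : ∀ s n → 2 ℕ.^ s ≤ n → n < 2 ℕ.^ suc s → Val≡ 0 s (harmonic n)
harmonic-Val≡ s n 2^s≤n upper with ℕₚ.m≤n⇒∃[o]m+o≡n 2^s≤n
... | k , refl = from-2^s k upper
  where
  from-2^s : ∀ k → 2 ℕ.^ s ℕ.+ k < 2 ℕ.^ suc s → Val≡ 0 s (harmonic (2 ℕ.^ s ℕ.+ k))
  from-2^s zero _ with ℕₚ.m≤n⇒∃[o]m+o≡n (ℕₚ.m^n>0 2 s)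
  ... | m , 1+m≡2^s = subst (λ n → Val≡ 0 s (harmonic n)) (trans 1+m≡2^s (sym (ℕₚ.+-identityʳ _)))
    (subst (Val≡ 0 s) (ℚₚ.+-comm 1/[1+ m ] (harmonic m))
      (Val≡-+-Val≥ (1/[1+]-Val≡ m s 0 (trans 1+m≡2^s (sym (ℕₚ.*-identityʳ _))))
                   (harmonic-Val≥ s m (subst (m <_) 1+m≡2^s (ℕₚ.n<1+n m)))))
  from-2^s (suc k) upper = subst (λ n → Val≡ 0 s (harmonic n)) (sym (ℕₚ.+-suc (2 ℕ.^ s) k))
    (Val≡-+-Val≥ (from-2^s k (ℕₚ.<-trans (ℕₚ.n<1+n _) upper′))
                 (1/[1+]-Val≥ (2 ℕ.^ s ℕ.+ k) s upper′ (ℕₚ.>⇒≢ (s≤s (ℕₚ.m≤m+n (2 ℕ.^ s) k)))))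
    where
    upper′ : suc (2 ℕ.^ s ℕ.+ k) < 2 ℕ.^ suc s
    upper′ = subst (_< 2 ℕ.^ suc s) (ℕₚ.+-suc (2 ℕ.^ s) k) upper

oddHarmonic : ℕ → ℚ
oddHarmonic zero    = 1/[1+ 0 ]
oddHarmonic (suc m) = oddHarmonic m ℚ.+ 1/[1+ 2 ℕ.* suc m ]

2*[1+m]≡2+2*m : ∀ m → 2 ℕ.* suc m ≡ suc (suc (2 ℕ.* m))
2*[1+m]≡2+2*m m = ℕₚ.*-suc 2 m

1/[2+2m]≡1/[1+m]*½ : ∀ m → 1/[1+ suc (2 ℕ.* m) ] ≡ 1/[1+ m ] ℚ.* 1/[1+ 1 ]
1/[2+2m]≡1/[1+m]*½ m = 1/[1+]-* m 1 (suc (2 ℕ.* m)) (double m)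
  where
  double : ∀ m → suc (suc (2 ℕ.* m)) ≡ suc m ℕ.* 2
  double = ℕ-Solver.solve-∀

harmonic-odd-split : ∀ m → harmonic (suc (2 ℕ.* m)) ≡ harmonic m ℚ.* 1/[1+ 1 ] ℚ.+ oddHarmonic m
harmonic-odd-split zero    = refl
harmonic-odd-split (suc m) = begin
  harmonic (suc (2 ℕ.* suc m))
    ≡⟨ cong (λ k → harmonic (suc k)) (2*[1+m]≡2+2*m m) ⟩
  harmonic (suc (2 ℕ.* m)) ℚ.+ 1/[1+ suc (2 ℕ.* m) ] ℚ.+ 1/[1+ 2+2m ]
    ≡⟨ cong₂ (λ a b → a ℚ.+ b ℚ.+ 1/[1+ 2+2m ]) (harmonic-odd-split m) (1/[2+2m]≡1/[1+m]*½ m) ⟩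
  harmonic m ℚ.* 1/[1+ 1 ] ℚ.+ oddHarmonic m ℚ.+ 1/[1+ m ] ℚ.* 1/[1+ 1 ] ℚ.+ 1/[1+ 2+2m ]
    ≡⟨ regroup (harmonic m) (1/[1+ 1 ]) (oddHarmonic m) 1/[1+ m ] 1/[1+ 2+2m ] ⟩
  (harmonic m ℚ.+ 1/[1+ m ]) ℚ.* 1/[1+ 1 ] ℚ.+ (oddHarmonic m ℚ.+ 1/[1+ 2+2m ])
    ≡⟨ cong (λ k → harmonic (suc m) ℚ.* 1/[1+ 1 ] ℚ.+ (oddHarmonic m ℚ.+ 1/[1+ k ])) (sym (2*[1+m]≡2+2*m m)) ⟩
  harmonic (suc m) ℚ.* 1/[1+ 1 ] ℚ.+ oddHarmonic (suc m) ∎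
  where
  2+2m : ℕ
  2+2m = suc (suc (2 ℕ.* m))
  regroup : ∀ h ½ o r t → h ℚ.* ½ ℚ.+ o ℚ.+ r ℚ.* ½ ℚ.+ t ≡ (h ℚ.+ r) ℚ.* ½ ℚ.+ (o ℚ.+ t)
  regroup = solve 5 (λ h ½ o r t → h :* ½ :+ o :+ r :* ½ :+ t := (h :+ r) :* ½ :+ (o :+ t)) refl

oddHarmonic-Val≥ : ∀ m → Val≥ 0 0 (oddHarmonic m)
oddHarmonic-Val≥ zero    = lower (1/[1+2m]-Val≡ 0)
oddHarmonic-Val≥ (suc m) = Val≥-+ (oddHarmonic-Val≥ m) (lower (1/[1+2m]-Val≡ (suc m)))

odd-increment : ℕ → ℚ
odd-increment m = harmonic (2 ℕ.* m) ℚ.* 1/[1+ 2 ℕ.* m ]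

harmonic₂-defect : ℕ → ℚ
harmonic₂-defect zero    = 0ℚ
harmonic₂-defect (suc m) = harmonic₂-defect m ℚ.+ odd-increment m ℚ.+ oddHarmonic m ℚ.* (1/[1+ m ] ℚ.* 1/[1+ 1 ])

harmonic₂-double : ∀ m → harmonic₂ (2 ℕ.* m) ≡ harmonic₂ m ℚ.* (1/[1+ 1 ] ℚ.* 1/[1+ 1 ]) ℚ.+ harmonic₂-defect m
harmonic₂-double zero    = refl
harmonic₂-double (suc m) = begin
  harmonic₂ (2 ℕ.* suc m)
    ≡⟨ cong harmonic₂ (2*[1+m]≡2+2*m m) ⟩
  harmonic₂ (2 ℕ.* m) ℚ.+ odd-increment m ℚ.+ harmonic (suc (2 ℕ.* m)) ℚ.* 1/[1+ suc (2 ℕ.* m) ]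
    ≡⟨ cong₂ (λ a b → a ℚ.+ odd-increment m ℚ.+ b) (harmonic₂-double m)
             (cong₂ ℚ._*_ (harmonic-odd-split m) (1/[2+2m]≡1/[1+m]*½ m)) ⟩
  harmonic₂ m ℚ.* (1/[1+ 1 ] ℚ.* 1/[1+ 1 ]) ℚ.+ harmonic₂-defect m ℚ.+ odd-increment m
    ℚ.+ (harmonic m ℚ.* 1/[1+ 1 ] ℚ.+ oddHarmonic m) ℚ.* (1/[1+ m ] ℚ.* 1/[1+ 1 ])
    ≡⟨ regroup (harmonic₂ m) (1/[1+ 1 ]) (harmonic₂-defect m) (odd-increment m) (harmonic m) (oddHarmonic m) 1/[1+ m ] ⟩
  (harmonic₂ m ℚ.+ harmonic m ℚ.* 1/[1+ m ]) ℚ.* (1/[1+ 1 ] ℚ.* 1/[1+ 1 ]) ℚ.+ harmonic₂-defect (suc m) ∎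
  where
  regroup : ∀ h₂ ½ d i h o r → h₂ ℚ.* (½ ℚ.* ½) ℚ.+ d ℚ.+ i ℚ.+ (h ℚ.* ½ ℚ.+ o) ℚ.* (r ℚ.* ½)
                            ≡ (h₂ ℚ.+ h ℚ.* r) ℚ.* (½ ℚ.* ½) ℚ.+ (d ℚ.+ i ℚ.+ o ℚ.* (r ℚ.* ½))
  regroup = solve 7 (λ h₂ ½ d i h o r → h₂ :* (½ :* ½) :+ d :+ i :+ (h :* ½ :+ o) :* (r :* ½)
                                     := (h₂ :+ h :* r) :* (½ :* ½) :+ (d :+ i :+ o :* (r :* ½))) refl

harmonic₂-2m+0 : ∀ m → harmonic₂ (2 ℕ.* m ℕ.+ bit false) ≡ harmonic₂ (2 ℕ.* m)
harmonic₂-2m+0 m = cong harmonic₂ (ℕₚ.+-identityʳ (2 ℕ.* m))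

harmonic₂-2m+1 : ∀ m → harmonic₂ (2 ℕ.* m ℕ.+ bit true) ≡ harmonic₂ (2 ℕ.* m ℕ.+ bit false) ℚ.+ odd-increment m
harmonic₂-2m+1 m = trans (cong harmonic₂ (ℕₚ.+-comm (2 ℕ.* m) 1))
                         (cong (ℚ._+ odd-increment m) (sym (harmonic₂-2m+0 m)))

¼-Val≡ : Val≡ 0 2 (1/[1+ 1 ] ℚ.* 1/[1+ 1 ])
¼-Val≡ = Val≡-* ½-Val≡ ½-Val≡

odd-increment-Val≥ : ∀ j m → m < 2 ℕ.^ suc j → Val≥ 0 (suc j) (odd-increment m)
odd-increment-Val≥ j m upper = Val≥-mono
  (Val≥-* (harmonic-Val≥ (suc (suc j)) (2 ℕ.* m) (ℕₚ.*-monoʳ-< 2 upper)) (lower (1/[1+2m]-Val≡ m)))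
  (ℕₚ.≤-reflexive (ℕₚ.+-identityʳ (suc (suc j))))

odd-increment-Val≡ : ∀ t m → 2 ℕ.^ t ≤ m → m < 2 ℕ.^ suc t → Val≡ 0 (suc t) (odd-increment m)
odd-increment-Val≡ t m lower-bound upper = Val≡-mono
  (Val≡-* (harmonic-Val≡ (suc t) (2 ℕ.* m) (ℕₚ.*-monoʳ-≤ 2 lower-bound) (ℕₚ.*-monoʳ-< 2 upper)) (1/[1+2m]-Val≡ m))
  (ℕₚ.+-identityʳ (suc t))

harmonic₂-defect-Val≥ : ∀ j m → m < 2 ℕ.^ suc j → Val≥ 0 (suc j) (harmonic₂-defect m)
harmonic₂-defect-Val≥ j zero    _     = Val≥-zero 0 (suc j)
harmonic₂-defect-Val≥ j (suc m) upper = Val≥-+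
  (Val≥-+ (harmonic₂-defect-Val≥ j m m<) (odd-increment-Val≥ j m m<))
  (Val≥-mono (Val≥-* (oddHarmonic-Val≥ m) (Val≥-* (1/[1+]-Val≥-below m (suc j) upper) (lower ½-Val≡)))
             (ℕₚ.≤-reflexive (ℕₚ.+-comm (suc j) 1)))
  where
  m< : m < 2 ℕ.^ suc j
  m< = ℕₚ.<-trans (ℕₚ.n<1+n m) upper

harmonic₂-double-Val≥ : ∀ t m → m < 2 ℕ.^ suc t → Val≥ 1 t (harmonic₂ m) →
                        Val≥ 0 (suc t) (harmonic₂ (2 ℕ.* m ℕ.+ bit false))
harmonic₂-double-Val≥ t m upper v = subst (Val≥ 0 (suc t)) (sym (trans (harmonic₂-2m+0 m) (harmonic₂-double m)))
  (Val≥-+ (Val≥-mono (Val≥-* v (lower ¼-Val≡)) (ℕₚ.≤-reflexive (ℕₚ.+-comm t 2)))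
          (harmonic₂-defect-Val≥ t m upper))

[1+r]+[1+j]≤2*[1+j] : ∀ {r j} → r ≤ j → suc r ℕ.+ suc j ≤ 2 ℕ.* suc j
[1+r]+[1+j]≤2*[1+j] {r} {j} r≤j = ℕₚ.≤-trans (ℕₚ.+-monoˡ-≤ (suc j) (s≤s r≤j)) (ℕₚ.≤-reflexive (double j))
  where
  double : ∀ j → suc j ℕ.+ suc j ≡ 2 ℕ.* suc j
  double = ℕ-Solver.solve-∀

harmonic₂-append-Val≡ : ∀ b r j m → r ≤ j → m < 2 ℕ.^ suc j → Val≡ r (2 ℕ.* j) (harmonic₂ m) →
                        Val≡ r (2 ℕ.* suc j) (harmonic₂ (2 ℕ.* m ℕ.+ bit b))
harmonic₂-append-Val≡ false r j m r≤j upper u = subst (Val≡ r (2 ℕ.* suc j))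
  (sym (trans (harmonic₂-2m+0 m) (harmonic₂-double m)))
  (Val≡-+-Val≥ (Val≡-mono (Val≡-* u ¼-Val≡) (levels r j))
               (Val≥-mono (harmonic₂-defect-Val≥ j m upper) ([1+r]+[1+j]≤2*[1+j] r≤j)))
  where
  levels : ∀ r j → r ℕ.+ (2 ℕ.* j ℕ.+ 2) ≡ r ℕ.+ 0 ℕ.+ 2 ℕ.* suc j
  levels = ℕ-Solver.solve-∀
harmonic₂-append-Val≡ true r j m r≤j upper u = subst (Val≡ r (2 ℕ.* suc j)) (sym (harmonic₂-2m+1 m))
  (Val≡-+-Val≥ (harmonic₂-append-Val≡ false r j m r≤j upper u)
               (Val≥-mono (odd-increment-Val≥ j m upper) ([1+r]+[1+j]≤2*[1+j] r≤j)))

-- h₂(2m + 1) − h₂(2m) has valuation exactly −(t + 1), so of the two siblings exactly one is ≥ 1 − (t + 1).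
module Siblings (t m : ℕ) (lower-bound : 2 ℕ.^ t ≤ m) (upper : m < 2 ℕ.^ suc t) where

  private
    increment : Val≡ 0 (suc t) (odd-increment m)
    increment = odd-increment-Val≡ t m lower-bound upper
    even : ℚ
    even = harmonic₂ (2 ℕ.* m ℕ.+ bit false)

    drop-increment : ∀ x u → ℚ.- u ℚ.+ (x ℚ.+ u) ≡ x
    drop-increment = solve 2 (λ x u → :- u :+ (x :+ u) := x) refl
    drop-increment′ : ∀ x u → x ℚ.+ u ℚ.+ ℚ.- u ≡ x
    drop-increment′ = solve 2 (λ x u → x :+ u :+ :- u := x) refl

  sibling-Val≡ : ∀ b → Val≥ 1 (suc t) (harmonic₂ (2 ℕ.* m ℕ.+ bit b)) →
                 Val≡ 0 (suc t) (harmonic₂ (2 ℕ.* m ℕ.+ bit (not b)))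
  sibling-Val≡ false v = subst (Val≡ 0 (suc t)) (trans (ℚₚ.+-comm (odd-increment m) even) (sym (harmonic₂-2m+1 m)))
    (Val≡-+-Val≥ increment v)
  sibling-Val≡ true  v = subst (Val≡ 0 (suc t)) (drop-increment even (odd-increment m))
    (Val≡-+-Val≥ (Val≡-neg increment) (subst (Val≥ 1 (suc t)) (harmonic₂-2m+1 m) v))

  sibling-Val≥ : ∀ b → Val≡ 0 (suc t) (harmonic₂ (2 ℕ.* m ℕ.+ bit b)) →
                 Val≥ 1 (suc t) (harmonic₂ (2 ℕ.* m ℕ.+ bit (not b)))
  sibling-Val≥ false u = subst (Val≥ 1 (suc t)) (sym (harmonic₂-2m+1 m)) (Val≡-+-Val≡ u increment)
  sibling-Val≥ true  u = subst (Val≥ 1 (suc t)) (drop-increment′ even (odd-increment m))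
    (Val≡-+-Val≡ (subst (Val≡ 0 (suc t)) (harmonic₂-2m+1 m) u) (Val≡-neg increment))

-- The digit sequence

bit≤1 : ∀ b → bit b ≤ 1
bit≤1 true  = s≤s z≤n
bit≤1 false = z≤n

bin-< : ∀ s d → bin s d < 2 ℕ.^ suc s
bin-< zero    d = s≤s (bit≤1 (d 0))
bin-< (suc s) d = ℕₚ.≤-trans (s≤s (ℕₚ.+-monoʳ-≤ (2 ℕ.* bin s d) (bit≤1 (d (suc s)))))
                             (ℕₚ.≤-trans (ℕₚ.≤-reflexive (shift (bin s d))) (ℕₚ.*-monoʳ-≤ 2 (bin-< s d)))
  where
  shift : ∀ b → suc (2 ℕ.* b ℕ.+ 1) ≡ 2 ℕ.* suc b
  shift = ℕ-Solver.solve-∀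

bin-≥ : ∀ s d → d 0 ≡ true → 2 ℕ.^ s ≤ bin s d
bin-≥ zero    d d0≡1 rewrite d0≡1 = ℕₚ.≤-refl
bin-≥ (suc s) d d0≡1 = ℕₚ.≤-trans (ℕₚ.*-monoʳ-≤ 2 (bin-≥ s d d0≡1)) (ℕₚ.m≤m+n _ _)

bin-cong : ∀ s d e → (∀ i → i ≤ s → d i ≡ e i) → bin s d ≡ bin s e
bin-cong zero    d e d≗e = cong bit (d≗e 0 z≤n)
bin-cong (suc s) d e d≗e = cong₂ (λ m b → 2 ℕ.* m ℕ.+ bit b)
  (bin-cong s d e (λ i i≤s → d≗e i (ℕₚ.m≤n⇒m≤1+n i≤s))) (d≗e (suc s) ℕₚ.≤-refl)

Bound : ℕ → ℕ → Set
Bound s n = + 1 ℤ.- + s ℤ.≤ ν₂ (H n 2)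

bound? : ∀ s n → Dec (Bound s n)
bound? s n = + 1 ℤ.- + s ℤ.≤? ν₂ (H n 2)

Bound⇔Val≥ : ∀ s n → 1 ≤ s → Bound s n ⇔ Val≥ 1 s (harmonic₂ n)
Bound⇔Val≥ s n 1≤s = mk⇔
  (λ b → Val≥-ν₂ (subst (+ 1 ℤ.- + s ℤ.≤_) (cong ν₂ (H≡harmonic₂ n)) b))
  (λ v → subst (+ 1 ℤ.- + s ℤ.≤_) (cong ν₂ (sym (H≡harmonic₂ n))) (ν₂-Val≥ 1≤s v))

mutual
  prefix : ℕ → ℕ
  prefix zero    = 1
  prefix (suc s) = 2 ℕ.* prefix s ℕ.+ bit (nextDigit s)

  nextDigit : ℕ → Bool
  nextDigit s = isYes (bound? (suc s) (2 ℕ.* prefix s ℕ.+ 1))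

digits : ℕ → Bool
digits zero    = true
digits (suc s) = nextDigit s

bin-digits : ∀ s → bin s digits ≡ prefix s
bin-digits zero    = refl
bin-digits (suc s) = cong (λ m → 2 ℕ.* m ℕ.+ bit (nextDigit s)) (bin-digits s)

prefix-≥ : ∀ s → 2 ℕ.^ s ≤ prefix s
prefix-≥ s = subst (2 ℕ.^ s ≤_) (bin-digits s) (bin-≥ s digits refl)

prefix-< : ∀ s → prefix s < 2 ℕ.^ suc s
prefix-< s = subst (_< 2 ℕ.^ suc s) (bin-digits s) (bin-< s digits)

prefix-Val≥ : ∀ s → Val≥ 1 s (harmonic₂ (prefix s))
prefix-Val≥ zero    = Val≥-zero 1 0
prefix-Val≥ (suc t) = append (bound? (suc t) (2 ℕ.* prefix t ℕ.+ 1))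
  where
  open Siblings t (prefix t) (prefix-≥ t) (prefix-< t)
  append : (d : Dec (Bound (suc t) (2 ℕ.* prefix t ℕ.+ 1))) →
           Val≥ 1 (suc t) (harmonic₂ (2 ℕ.* prefix t ℕ.+ bit (isYes d)))
  append (yes b) = Equivalence.to (Bound⇔Val≥ (suc t) (2 ℕ.* prefix t ℕ.+ 1) (s≤s z≤n)) b
  -- The even child is ≥ −(t+1); were it exactly −(t+1), the odd child would satisfy the bound.
  append (no ¬b) = Val≥∧¬Val≡⇒Val≥-suc (harmonic₂-double-Val≥ t (prefix t) (prefix-< t) (prefix-Val≥ t))
    (λ u → ¬b (Equivalence.from (Bound⇔Val≥ (suc t) (2 ℕ.* prefix t ℕ.+ 1) (s≤s z≤n)) (sibling-Val≥ false u)))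

isYes≡true⇔ : ∀ {P : Set} (d : Dec P) → (isYes d ≡ true) ⇔ P
isYes≡true⇔ (yes p) = mk⇔ (λ _ → p) (λ _ → refl)
isYes≡true⇔ (no ¬p) = mk⇔ (λ ()) (λ p → ⊥-elim (¬p p))

≡ᵇ-refl : ∀ n → (n ≡ᵇ n) ≡ true
≡ᵇ-refl zero    = refl
≡ᵇ-refl (suc n) = ≡ᵇ-refl n

<⇒≡ᵇ-false : ∀ {m n} → m < n → (m ≡ᵇ n) ≡ false
<⇒≡ᵇ-false {zero}  {suc n} _         = refl
<⇒≡ᵇ-false {suc m} {suc n} (s≤s m<n) = <⇒≡ᵇ-false m<n

bin-digits-then-1 : ∀ t → bin (suc t) (λ i → if i ≡ᵇ suc t then true else digits i) ≡ 2 ℕ.* prefix t ℕ.+ 1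
bin-digits-then-1 t = cong₂ (λ m b → 2 ℕ.* m ℕ.+ bit b)
  (trans (bin-cong t _ digits (λ i i≤t → cong (λ b → if b then true else digits i) (<⇒≡ᵇ-false (s≤s i≤t))))
         (bin-digits t))
  (cong (λ b → if b then true else nextDigit t) (≡ᵇ-refl t))

bin-agreeing : ∀ s d → (∀ i → i ≤ s → d i ≡ digits i) → bin s d ≡ prefix s
bin-agreeing s d agree = trans (bin-cong s d digits agree) (bin-digits s)

deviation-Val≡ : ∀ t d → (∀ i → i ≤ t → d i ≡ digits i) → d (suc t) ≢ digits (suc t) →
                 Val≡ 0 (suc t) (harmonic₂ (bin (suc t) d))
deviation-Val≡ t d agree deviates = subst (λ n → Val≡ 0 (suc t) (harmonic₂ n))
  (cong₂ (λ m b → 2 ℕ.* m ℕ.+ bit b) (sym (bin-agreeing t d agree)) (sym (¬-not deviates)))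
  (sibling-Val≡ (nextDigit t) (prefix-Val≥ (suc t)))
  where open Siblings t (prefix t) (prefix-≥ t) (prefix-< t)

deviation-propagates : ∀ r d k → Val≡ r (2 ℕ.* r) (harmonic₂ (bin r d)) →
                       Val≡ r (2 ℕ.* (r ℕ.+ k)) (harmonic₂ (bin (r ℕ.+ k) d))
deviation-propagates r d zero u = subst (λ j → Val≡ r (2 ℕ.* j) (harmonic₂ (bin j d))) (sym (ℕₚ.+-identityʳ r)) u
deviation-propagates r d (suc k) u = subst (λ j → Val≡ r (2 ℕ.* j) (harmonic₂ (bin j d))) (sym (ℕₚ.+-suc r k))
  (harmonic₂-append-Val≡ (d (suc (r ℕ.+ k))) r (r ℕ.+ k) (bin (r ℕ.+ k) d) (ℕₚ.m≤m+n r k) (bin-< (r ℕ.+ k) d)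
    (deviation-propagates r d k u))

Bound-agreeing : ∀ s d → 1 ≤ s → (∀ i → i ≤ s → d i ≡ digits i) → Bound s (bin s d)
Bound-agreeing s d 1≤s agree = Equivalence.from (Bound⇔Val≥ s (bin s d) 1≤s)
  (subst (λ n → Val≥ 1 s (harmonic₂ n)) (sym (bin-agreeing s d agree)) (prefix-Val≥ s))

deviating-ν₂ : ∀ s d r → 1 ≤ r → r ≤ s → (∀ i → i < r → d i ≡ digits i) → d r ≢ digits r →
               ν₂ (H (bin s d) 2) ≡ + r ℤ.- + (2 ℕ.* s)
deviating-ν₂ s d (suc t) _ r≤s agree deviates with ℕₚ.m≤n⇒∃[o]m+o≡n r≤s
... | k , refl = trans (cong ν₂ (H≡harmonic₂ (bin (suc t ℕ.+ k) d))) (ν₂-Val≡ (deviation-propagates (suc t) d k at-r))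
  where
  levels : ∀ t → suc t ℕ.+ suc t ≡ 0 ℕ.+ 2 ℕ.* suc t
  levels = ℕ-Solver.solve-∀
  at-r : Val≡ (suc t) (2 ℕ.* suc t) (harmonic₂ (bin (suc t) d))
  at-r = Val≡-mono (deviation-Val≡ t d (λ i i≤t → agree i (s≤s i≤t)) deviates) (levels t)

corollary2p2 : Σ[ f ∈ (ℕ → Bool) ] ((f 0 ≡ true)
    × (∀ (s : ℕ) → 1 ≤ s →
    (f s ≡ true ⇔ ν₂ (H (bin s (λ i → if i ≡ᵇ s then true else f i)) 2) ≥ (+ 1) - (+ s)))
    × (∀ (s : ℕ) (d : ℕ → Bool) → 1 ≤ s → d 0 ≡ true →
    ((∀ i → i ≤ s → d i ≡ f i) → ν₂ (H (bin s d) 2) ≥ (+ 1) - (+ s))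
    × (∀ r → 1 ≤ r → r ≤ s → (∀ i → i < r → d i ≡ f i) → d r ≢ f r →
    ν₂ (H (bin s d) 2) ≡ (+ r) - ((+ 2) * (+ s))))
    × (f 1 ≡ true) × (f 2 ≡ false))
corollary2p2 = digits , refl , next-digit ,
  -- d 0 ≡ true is implied by the agreement hypotheses.
  (λ s d 1≤s _ → Bound-agreeing s d 1≤s ,
                 λ r 1≤r r≤s agree deviates → trans (deviating-ν₂ s d r 1≤r r≤s agree deviates)
                                                     (cong (ℤ._-_ (+ r)) (ℤₚ.pos-* 2 s))) ,
  refl , refl
  where
  next-digit : ∀ s → 1 ≤ s → (digits s ≡ true) ⇔ Bound s (bin s (λ i → if i ≡ᵇ s then true else digits i))
  next-digit (suc t) _ = subst (λ n → (digits (suc t) ≡ true) ⇔ Bound (suc t) n) (sym (bin-digits-then-1 t))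
    (isYes≡true⇔ (bound? (suc t) (2 ℕ.* prefix t ℕ.+ 1)))
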